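{- Let $n\ge2$ and let $\tau\in S_n$ be a permutation which is not the long element $i\mapsto n+1-i$. Let $\Delta(\tau)=\{i\in\{1,\dots,n-1\}:\tau(\{1,\dots,i\})\neq\{n-i+1,\dots,n\}\}$. Then there exist real numbers $b_1>b_2>\cdots>b_{n-1}>b_n=0$ such that $$\frac{b_1+b_2+\cdots+b_i+b_{\tau^{ -1}(1)}+\cdots+b_{\tau^{ -1}(i)}}{2i}>\frac{b_1+b_2+\cdots+b_n}{n}$$ holds simultaneously for every $i\in\Delta(\tau)$. -}

module Defs where

open import Data.Nat as ℕ using (ℕ; suc; _∸_)
open import Data.Fin using (Fin; toℕ)
open import Data.Fin.Permutation using (Permutation′; _⟨$⟩ʳ_; _⟨$⟩ˡ_)
open import Data.Rational using (ℚ; 0ℚ; _+_)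
open import Data.List using (List; foldr; filter; allFin)
open import Data.Product using (∃; _×_)
open import Function.Bundles using (_⇔_)
open import Relation.Binary.PropositionalEquality using (_≡_)
open import Relation.Nullary using (¬_)

-- Convention: {1,…,n} is represented by Fin n, with paper index k ↦ Fin element k-1.

sumFirst : ∀ {n} → (Fin n → ℚ) → ℕ → ℚ
sumFirst {n} f i = foldr (λ j acc → f j + acc) 0ℚ (filter (λ j → toℕ j ℕ.<? i) (allFin n))

-- τ({1,…,i}) = {n-i+1,…,n}, as an equality of subsets of {1,…,n}.
-- (0-indexed: image of {0,…,i-1} equals {n-i,…,n-1}.)
ImageIsTop : ∀ {n} → Permutation′ n → ℕ → Set
ImageIsTop {n} τ i =
  ∀ (y : Fin n) → (∃ λ (j : Fin n) → (toℕ j ℕ.< i) × (τ ⟨$⟩ʳ j ≡ y)) ⇔ (n ∸ i ℕ.≤ toℕ y)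

-- i ∈ Δ(τ) (for i ∈ {1,…,n-1}, the range condition is imposed separately)
InΔ : ∀ {n} → Permutation′ n → ℕ → Set
InΔ τ i = ¬ ImageIsTop τ i

{-# OPTIONS --safe #-}
module Submission where

-- Write L p = n − p for p ∈ {1,…,n} and take b p = n·L p + L (τ p), minus the constant that makes b n = 0;
-- a common shift of all b p changes neither side of the inequality, and the term n·L p makes b strictly
-- decreasing. With A = Σ_{p≤i} L p, Iσ = Σ_{p≤i} L (τ⁻¹ p) and Iτ = Σ_{p≤i} L (τ p), 2i times the left-hand
-- side is n(A + Iσ) + (A + Iτ), and 2i times the right-hand side is i(n+1)(n−1). Any i distinct values of L
-- sum to at least Z = 0 + 1 + … + (i−1) = i(n−1) − A, with equality only for the i smallest ones. Hence
-- Iσ ≥ Z, and Iτ > Z exactly when τ({1,…,i}) ≠ {n−i+1,…,n}, that is when i ∈ Δ(τ); then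
-- n(A + Iσ) + (A + Iτ) > (n+1)(A + Z) = i(n+1)(n−1).

open import Defs
open import Data.Nat using (ℕ; suc)
open import Data.Fin.Permutation using (Permutation′)

module Arithmetic where
  open import Data.Nat using (suc; _+_; _*_; _∸_; _≤_; _<_)
  open import Data.Nat.Properties
  open import Data.Nat.Tactic.RingSolver using (solve-∀)
  open import Relation.Binary.PropositionalEquality

  ∸-≤-swap : ∀ m n o → m ∸ n ≤ o → m ∸ o ≤ n
  ∸-≤-swap m n o m∸n≤o = m≤n+o⇒m∸n≤o m o
    (≤-trans (m≤n+m∸n m n) (≤-trans (+-monoʳ-≤ n m∸n≤o) (≤-reflexive (+-comm n o))))

  averages-shift-< : ∀ n i X Y c X₀ Y₀ → X + (i * c + i * c) ≡ X₀ → Y + n * c ≡ Y₀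
    → 2 * i * Y₀ < n * X₀ → 2 * i * Y < n * X
  averages-shift-< n i X Y c X₀ Y₀ refl refl lt = +-cancelʳ-< (n * (i * c + i * c)) (2 * i * Y) (n * X)
    (subst₂ _<_ (shift-Y n i Y c) (*-distribˡ-+ n X (i * c + i * c)) lt)
    where
    shift-Y : ∀ n i Y c → 2 * i * (Y + n * c) ≡ 2 * i * Y + n * (i * c + i * c)
    shift-Y = solve-∀

  rearranged-averages-< : ∀ n₁ i A Z Iσ Iτ Q → Z ≤ Iσ → Z < Iτ → A + Z ≡ i * n₁ → Q + Q ≡ suc n₁ * n₁
    → 2 * i * (suc n₁ * Q + Q) < suc n₁ * ((suc n₁ * A + Iτ) + (suc n₁ * Iσ + A))
  rearranged-averages-< n₁ i A Z Iσ Iτ Q Z≤Iσ Z<Iτ A+Z Q+Q = begin-strict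
      2 * i * (n * Q + Q)              ≡⟨ e₁ n i Q ⟩
      (n + 1) * i * (Q + Q)            ≡⟨ cong ((n + 1) * i *_) Q+Q ⟩
      (n + 1) * i * (n * n₁)           ≡⟨ e₂ n i n₁ ⟩
      (n * n + n) * (i * n₁)           ≡⟨ cong ((n * n + n) *_) A+Z ⟨
      (n * n + n) * (A + Z)            ≡⟨ *-distribʳ-+ (A + Z) (n * n) n ⟩
      n * n * (A + Z) + n * (A + Z)    <⟨ +-mono-≤-< (*-monoʳ-≤ (n * n) (+-monoʳ-≤ A Z≤Iσ))
                                                      (*-monoʳ-< n (+-monoʳ-< A Z<Iτ)) ⟩
      n * n * (A + Iσ) + n * (A + Iτ)  ≡⟨ e₃ n A Iσ Iτ ⟨
      n * ((n * A + Iτ) + (n * Iσ + A)) ∎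
    where
    open ≤-Reasoning
    n = suc n₁
    e₁ : ∀ n i Q → 2 * i * (n * Q + Q) ≡ (n + 1) * i * (Q + Q)
    e₁ = solve-∀
    e₂ : ∀ n i n₁ → (n + 1) * i * (n * n₁) ≡ (n * n + n) * (i * n₁)
    e₂ = solve-∀
    e₃ : ∀ n A Iσ Iτ → n * ((n * A + Iτ) + (n * Iσ + A)) ≡ n * n * (A + Iσ) + n * (A + Iτ)
    e₃ = solve-∀

module FinSums where
  open import Data.Nat using (ℕ; zero; suc; _+_; _*_; _≤_; _<_; z≤n; s≤s; z<s; _<?_; s≤s⁻¹)
  open import Data.Nat.Properties
  open import Data.Fin using (Fin; toℕ) renaming (zero to fzero; suc to fsuc)
  open import Data.Fin.Properties using (toℕ<n)
  open import Data.Fin.Permutation using (Permutation′; _⟨$⟩ʳ_; _⟨$⟩ˡ_; inverseʳ; flip)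
  open import Algebra.Properties.Semiring.Sum +-*-semiring
    using (sum; sum-syntax; ∑-distrib-+; ∑-permute; sum-cong-≗; *-distribˡ-sum; *-distribʳ-sum)
  open import Algebra.Properties.CommutativeSemigroup *-commutativeSemigroup using (x∙yz≈y∙xz)
  open import Function using (_∘_)
  open import Relation.Nullary using (Dec; yes; no; ¬_)
  open import Relation.Nullary.Negation using (contradiction)
  open import Relation.Binary.PropositionalEquality

  ∑-mono-≤ : ∀ {n} {f g : Fin n → ℕ} → (∀ p → f p ≤ g p) → sum f ≤ sum g
  ∑-mono-≤ {zero} f≤g = z≤n
  ∑-mono-≤ {suc n} f≤g = +-mono-≤ (f≤g fzero) (∑-mono-≤ (f≤g ∘ fsuc))

  ∑-mono-< : ∀ {n} {f g : Fin n → ℕ} → (∀ p → f p ≤ g p) → ∀ p → f p < g p → sum f < sum g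
  ∑-mono-< f≤g fzero f<g = +-mono-<-≤ f<g (∑-mono-≤ (f≤g ∘ fsuc))
  ∑-mono-< f≤g (fsuc p) f<g = +-mono-≤-< (f≤g fzero) (∑-mono-< (f≤g ∘ fsuc) p f<g)

  ∑-const : ∀ n c → sum {n} (λ _ → c) ≡ n * c
  ∑-const zero c = refl
  ∑-const (suc n) c = cong (c +_) (∑-const n c)

  ∑-+-* : ∀ {n} (f g : Fin n → ℕ) c → sum (λ p → f p + g p * c) ≡ sum f + sum g * c
  ∑-+-* f g c = trans (∑-distrib-+ f (λ p → g p * c)) (cong (sum f +_) (sym (*-distribʳ-sum c g)))

  ∑-weighted-+ : ∀ {n} (w f g : Fin n → ℕ)
    → ∑[ p < n ] (w p * (f p + g p)) ≡ ∑[ p < n ] (w p * f p) + ∑[ p < n ] (w p * g p)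
  ∑-weighted-+ {n} w f g = trans (sum-cong-≗ {n} (λ p → *-distribˡ-+ (w p) (f p) (g p)))
    (∑-distrib-+ (λ p → w p * f p) (λ p → w p * g p))

  ∑-weighted-*ˡ : ∀ {n} (w f : Fin n → ℕ) c → ∑[ p < n ] (w p * (c * f p)) ≡ c * ∑[ p < n ] (w p * f p)
  ∑-weighted-*ˡ {n} w f c = trans (sum-cong-≗ {n} (λ p → x∙yz≈y∙xz (w p) c (f p)))
    (sym (*-distribˡ-sum c (λ p → w p * f p)))

  ∑-weighted-const : ∀ {n} (w : Fin n → ℕ) c → ∑[ p < n ] (w p * c) ≡ sum w * c
  ∑-weighted-const w c = sym (*-distribʳ-sum c w)

  𝟙 : ∀ {A : Set} → Dec A → ℕ
  𝟙 (yes _) = 1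
  𝟙 (no _) = 0

  𝟙-yes : ∀ {A : Set} → A → (a : Dec A) → 𝟙 a ≡ 1
  𝟙-yes x (yes _) = refl
  𝟙-yes x (no ¬x) = contradiction x ¬x

  𝟙-no : ∀ {A : Set} → ¬ A → (a : Dec A) → 𝟙 a ≡ 0
  𝟙-no ¬x (yes x) = contradiction x ¬x
  𝟙-no ¬x (no _) = refl

  below : ∀ {n} → ℕ → Fin n → ℕ
  below i p = 𝟙 (toℕ p <? i)

  ∑-below : ∀ {n i} → i ≤ n → sum (below {n} i) ≡ i
  ∑-below {n} {zero} z≤n = trans (sum-cong-≗ {n} (λ p → 𝟙-no (λ ()) (toℕ p <? 0))) (trans (∑-const n 0) (*-zeroʳ n))
  ∑-below {suc n} {suc i} (s≤s i≤n) =
    cong suc (trans (sum-cong-≗ {n} (λ p → below-suc p (toℕ p <? i))) (∑-below i≤n))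
    where
    below-suc : ∀ p (p<?i : Dec (toℕ p < i)) → below (suc i) (fsuc p) ≡ 𝟙 p<?i
    below-suc p (yes p<i) = 𝟙-yes (s≤s p<i) _
    below-suc p (no p≮i) = 𝟙-no (p≮i ∘ s≤s⁻¹) _

  ∑-below-permute : ∀ {n i} (ρ : Permutation′ n) → i ≤ n → sum (λ p → below i (ρ ⟨$⟩ʳ p)) ≡ i
  ∑-below-permute ρ i≤n = trans (sym (∑-permute _ ρ)) (∑-below i≤n)

  ∑-below-all : ∀ {n} (f : Fin n → ℕ) → ∑[ p < n ] (below n p * f p) ≡ sum f
  ∑-below-all {n} f = sum-cong-≗ {n} λ p → trans (cong (_* f p) (𝟙-yes (toℕ<n p) (toℕ p <? n))) (*-identityˡ (f p))

  1*x+0≡x : ∀ x → 1 * x + 0 ≡ x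
  1*x+0≡x x = trans (+-identityʳ (1 * x)) (*-identityˡ x)

  exchange-≤ : ∀ {A : Set} (a : Dec A) x i → 𝟙 (x <? i) * x + 𝟙 a * i ≤ 𝟙 a * x + 𝟙 (x <? i) * i
  exchange-≤ a x i with x <? i | a
  ... | yes _   | yes _ = ≤-refl
  ... | yes x<i | no _  = subst₂ _≤_ (sym (1*x+0≡x x)) (sym (*-identityˡ i)) (<⇒≤ x<i)
  ... | no x≮i  | yes _ = subst₂ _≤_ (sym (*-identityˡ i)) (sym (1*x+0≡x x)) (≮⇒≥ x≮i)
  ... | no _    | no _  = z≤n

  exchange-< : ∀ {A : Set} (a : Dec A) {x i} → x < i → ¬ A → 𝟙 (x <? i) * x + 𝟙 a * i < 𝟙 a * x + 𝟙 (x <? i) * i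
  exchange-< a {x} {i} x<i ¬a with x <? i | a
  ... | yes _ | no _ = subst₂ _<_ (sym (1*x+0≡x x)) (sym (*-identityˡ i)) x<i
  ... | no x≮i | _ = contradiction x<i x≮i
  ... | _ | yes a = contradiction a ¬a

  -- With S = ρ({0,…,i−1}) (indicator moved), summing exchange-≤ over all x gives
  -- Σ_{x<i} x + i·|S| ≤ Σ_{x∈S} x + i·i, and |S| = i.
  module _ {n i} (ρ : Permutation′ n) (i≤n : i ≤ n) where
    private
      moved : Fin n → ℕ
      moved y = below i (ρ ⟨$⟩ˡ y)

      ∑-moved : sum moved ≡ i
      ∑-moved = ∑-below-permute (flip ρ) i≤n

      ∑-rearranged : ∑[ p < n ] (below i p * toℕ (ρ ⟨$⟩ʳ p)) ≡ ∑[ y < n ] (moved y * toℕ y)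
      ∑-rearranged = trans (∑-permute (λ p → below i p * toℕ (ρ ⟨$⟩ʳ p)) (flip ρ))
        (sum-cong-≗ {n} λ y → cong (λ z → moved y * toℕ z) (inverseʳ ρ))

      exchange : ∀ y → below i y * toℕ y + moved y * i ≤ moved y * toℕ y + below i y * i
      exchange y = exchange-≤ (toℕ (ρ ⟨$⟩ˡ y) <? i) (toℕ y) i

      ∑-exchange-lhs : ∑[ y < n ] (below i y * toℕ y + moved y * i) ≡ ∑[ p < n ] (below i p * toℕ p) + i * i
      ∑-exchange-lhs = trans (∑-+-* (λ p → below i p * toℕ p) moved i)
        (cong (λ k → ∑[ p < n ] (below i p * toℕ p) + k * i) ∑-moved)

      ∑-exchange-rhs : ∑[ y < n ] (moved y * toℕ y + below i y * i) ≡ ∑[ p < n ] (below i p * toℕ (ρ ⟨$⟩ʳ p)) + i * i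
      ∑-exchange-rhs = trans (∑-+-* (λ y → moved y * toℕ y) (below i) i)
        (cong₂ (λ s k → s + k * i) (sym ∑-rearranged) (∑-below i≤n))

    ∑-below-toℕ-≤ : ∑[ p < n ] (below i p * toℕ p) ≤ ∑[ p < n ] (below i p * toℕ (ρ ⟨$⟩ʳ p))
    ∑-below-toℕ-≤ = +-cancelʳ-≤ (i * i) _ _
      (subst₂ _≤_ ∑-exchange-lhs ∑-exchange-rhs (∑-mono-≤ exchange))

    ∑-below-toℕ-< : ∀ y → toℕ y < i → ¬ toℕ (ρ ⟨$⟩ˡ y) < i
      → ∑[ p < n ] (below i p * toℕ p) < ∑[ p < n ] (below i p * toℕ (ρ ⟨$⟩ʳ p))
    ∑-below-toℕ-< y y<i ρ⁻¹y≮i = +-cancelʳ-< (i * i) _ _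
      (subst₂ _<_ ∑-exchange-lhs ∑-exchange-rhs
        (∑-mono-< exchange y (exchange-< (toℕ (ρ ⟨$⟩ˡ y) <? i) y<i ρ⁻¹y≮i)))

  below-reflected : ∀ {n i} (ρ : Permutation′ n) → i ≤ n → (∀ x → toℕ x < i → toℕ (ρ ⟨$⟩ʳ x) < i)
    → ∀ x → toℕ (ρ ⟨$⟩ʳ x) < i → toℕ x < i
  below-reflected {n} {i} ρ i≤n preserved x ρx<i with toℕ x <? i
  ... | yes x<i = x<i
  ... | no x≮i = contradiction (trans (∑-below i≤n) (sym (∑-below-permute ρ i≤n)))
      (<⇒≢ (∑-mono-< below≤below∘ρ x (subst₂ _<_ (sym (𝟙-no x≮i _)) (sym (𝟙-yes ρx<i _)) z<s)))
    where
    below≤below∘ρ : ∀ p → below i p ≤ below i (ρ ⟨$⟩ʳ p)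
    below≤below∘ρ p with toℕ p <? i
    ... | yes p<i = ≤-reflexive (sym (𝟙-yes (preserved p p<i) _))
    ... | no _ = z≤n

module TopImage where
  open import Data.Nat using (suc; _∸_; _≤_; _<_; _<?_)
  open import Data.Nat.Properties
  open import Data.Fin using (Fin; toℕ; opposite)
  open import Data.Fin.Properties using (toℕ<n; opposite-prop; opposite-involutive; any?)
  open import Data.Fin.Permutation using (Permutation′; _⟨$⟩ˡ_; _∘ₚ_; reverse; flip; inverseˡ; inverseʳ)
  open import Data.Product using (∃; _×_; _,_)
  open import Function.Bundles using (_⇔_; mk⇔; Equivalence)
  open import Relation.Nullary using (yes; no; ¬_; ¬?; _×-dec_)
  open import Relation.Nullary.Decidable using (decidable-stable)
  open import Relation.Nullary.Negation using (contradiction)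
  open import Relation.Binary.PropositionalEquality
  open FinSums
  open Arithmetic

  opposite<⇔∸≤ : ∀ {n i} (y : Fin n) → (toℕ (opposite y) < i) ⇔ (n ∸ i ≤ toℕ y)
  opposite<⇔∸≤ {n} {i} y = mk⇔
    (λ opp<i → ∸-≤-swap n (toℕ y) i (subst (_≤ i) suc[opp]≡n∸y opp<i))
    (λ n∸i≤y → subst (_≤ i) (sym suc[opp]≡n∸y) (∸-≤-swap n i (toℕ y) n∸i≤y))
    where
    suc[opp]≡n∸y : suc (toℕ (opposite y)) ≡ n ∸ toℕ y
    suc[opp]≡n∸y = trans (cong suc (opposite-prop y)) (sym (+-∸-assoc 1 (toℕ<n y)))

  InΔ⇒misplaced : ∀ {n i} (τ : Permutation′ n) → i ≤ n → InΔ τ i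
    → ∃ λ y → toℕ y < i × ¬ toℕ (τ ⟨$⟩ˡ opposite y) < i
  InΔ⇒misplaced {n} {i} τ i≤n Δ with any? (λ y → (toℕ y <? i) ×-dec ¬? (toℕ (τ ⟨$⟩ˡ opposite y) <? i))
  ... | yes misplaced = misplaced
  ... | no none = contradiction imageIsTop Δ
    -- τ⁻¹ then maps the top i values into the first i positions, hence onto them by counting.
    where
    kept : ∀ y → toℕ y < i → toℕ (τ ⟨$⟩ˡ opposite y) < i
    kept y y<i = decidable-stable (toℕ (τ ⟨$⟩ˡ opposite y) <? i) (λ lost → none (y , y<i , lost))

    reflected : ∀ y → toℕ (τ ⟨$⟩ˡ opposite y) < i → toℕ y < i
    reflected = below-reflected (flip (τ ∘ₚ reverse)) i≤n kept

    τ⁻¹<⇔opposite< : ∀ y → toℕ (τ ⟨$⟩ˡ y) < i ⇔ toℕ (opposite y) < i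
    τ⁻¹<⇔opposite< y = subst (λ z → toℕ (τ ⟨$⟩ˡ z) < i ⇔ toℕ (opposite y) < i) (opposite-involutive y)
      (mk⇔ (reflected (opposite y)) (kept (opposite y)))

    imageIsTop : ImageIsTop τ i
    imageIsTop y = mk⇔
      (λ { (j , j<i , refl) → Equivalence.to (opposite<⇔∸≤ y)
             (Equivalence.to (τ⁻¹<⇔opposite< y) (subst (λ k → toℕ k < i) (sym (inverseˡ τ)) j<i)) })
      (λ n∸i≤y → τ ⟨$⟩ˡ y
                , Equivalence.from (τ⁻¹<⇔opposite< y) (Equivalence.from (opposite<⇔∸≤ y) n∸i≤y)
                , inverseʳ τ)

module Embedding where
  open import Data.Nat as ℕ using (ℕ; suc; zero; _<?_)
  import Data.Nat.Properties as ℕ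
  import Data.Nat.Coprimality as Coprimality
  open import Data.Integer as ℤ using (+_)
  import Data.Integer.Properties as ℤ
  open import Data.Rational using (ℚ; mkℚ; 0ℚ; _+_; _*_; _/_; _<_; toℚᵘ)
  open import Data.Rational.Properties using (toℚᵘ-injective; toℚᵘ-homo-+; toℚᵘ-homo-*; toℚᵘ-fromℚᵘ; toℚᵘ-cancel-<)
  open import Data.Rational.Unnormalised as ℚᵘ using (mkℚᵘ; *≡*; *<*)
  import Data.Rational.Unnormalised.Properties as ℚᵘ
  open import Data.Fin as Fin using (Fin; toℕ)
  open import Data.List using (foldr; filter; tabulate)
  open import Data.List.Properties using (filter-accept; filter-reject)
  open import Function using (_∘_)
  open import Relation.Nullary using (yes; no)
  open import Relation.Binary.PropositionalEquality
  open FinSums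
  open import Algebra.Properties.Semiring.Sum ℕ.+-*-semiring using (sum-syntax)

  toℚ : ℕ → ℚ
  toℚ a = mkℚ (+ a) 0 (Coprimality.sym (Coprimality.1-coprimeTo a))

  toℚ-homo-+ : ∀ a b → toℚ (a ℕ.+ b) ≡ toℚ a + toℚ b
  toℚ-homo-+ a b = toℚᵘ-injective (ℚᵘ.≃-sym (ℚᵘ.≃-trans (toℚᵘ-homo-+ (toℚ a) (toℚ b)) (*≡* eq)))
    where
    eq : ((+ a ℤ.* + 1) ℤ.+ (+ b ℤ.* + 1)) ℤ.* + 1 ≡ + (a ℕ.+ b) ℤ.* + 1
    eq rewrite ℤ.*-identityʳ (+ a) | ℤ.*-identityʳ (+ b) | ℤ.*-identityʳ (+ a ℤ.+ + b) = sym (ℤ.pos-+ a b)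

  toℚ-mono-< : ∀ {a b} → a ℕ.< b → toℚ a < toℚ b
  toℚ-mono-< {a} {b} a<b =
    toℚᵘ-cancel-< (*<* (subst₂ ℤ._<_ (sym (ℤ.*-identityʳ (+ a))) (sym (ℤ.*-identityʳ (+ b))) (ℤ.+<+ a<b)))

  private
    toℚᵘ-toℚ-* : ∀ a d → toℚᵘ (toℚ a * (+ 1 / suc d)) ℚᵘ.≃ mkℚᵘ (+ a) d
    toℚᵘ-toℚ-* a d = ℚᵘ.≃-trans (toℚᵘ-homo-* (toℚ a) (+ 1 / suc d))
      (ℚᵘ.≃-trans (ℚᵘ.*-congˡ {mkℚᵘ (+ a) 0} (toℚᵘ-fromℚᵘ (mkℚᵘ (+ 1) d))) (*≡* eq))
      where
      eq : (+ a ℤ.* + 1) ℤ.* + suc d ≡ + a ℤ.* + suc (d ℕ.+ 0)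
      eq rewrite ℤ.*-identityʳ (+ a) | ℕ.+-identityʳ d = refl

  toℚ-ratio-< : ∀ {x y} d e → suc d ℕ.* y ℕ.< suc e ℕ.* x → toℚ y * (+ 1 / suc e) < toℚ x * (+ 1 / suc d)
  toℚ-ratio-< {x} {y} d e dy<ex = toℚᵘ-cancel-<
    (ℚᵘ.<-respˡ-≃ (ℚᵘ.≃-sym (toℚᵘ-toℚ-* y e)) (ℚᵘ.<-respʳ-≃ (ℚᵘ.≃-sym (toℚᵘ-toℚ-* x d)) (*<* cross)))
    where
    cross : + y ℤ.* + suc d ℤ.< + x ℤ.* + suc e
    cross rewrite sym (ℤ.pos-* y (suc d)) | sym (ℤ.pos-* x (suc e)) =
      ℤ.+<+ (subst₂ ℕ._<_ (ℕ.*-comm (suc d) y) (ℕ.*-comm (suc e) x) dy<ex)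

  sumFirst-toℚ : ∀ {n} i (f : Fin n → ℕ) → sumFirst (toℚ ∘ f) i ≡ toℚ (∑[ p < n ] (below i p ℕ.* f p))
  sumFirst-toℚ {n} i f = over-tabulate (λ p → p)
    where
    sumFirstOf : ∀ {k} → (Fin k → Fin n) → ℚ
    sumFirstOf e = foldr (λ j acc → toℚ (f j) + acc) 0ℚ (filter (λ j → toℕ j <? i) (tabulate e))

    over-tabulate : ∀ {k} (e : Fin k → Fin n) → sumFirstOf e ≡ toℚ (∑[ p < k ] (below i (e p) ℕ.* f (e p)))
    over-tabulate {zero} e = refl
    over-tabulate {suc k} e with toℕ (e Fin.zero) <? i
    ... | yes e₀<i rewrite filter-accept (λ j → toℕ j <? i) {x = e Fin.zero} {xs = tabulate (e ∘ Fin.suc)} e₀<i =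
      begin
        toℚ (f e₀) + sumFirstOf (e ∘ Fin.suc) ≡⟨ cong (λ q → toℚ (f e₀) + q) (over-tabulate (e ∘ Fin.suc)) ⟩
        toℚ (f e₀) + toℚ rest          ≡⟨ toℚ-homo-+ (f e₀) rest ⟨
        toℚ (f e₀ ℕ.+ rest)            ≡⟨ cong (λ c → toℚ (c ℕ.+ rest)) (ℕ.*-identityˡ (f e₀)) ⟨
        toℚ (1 ℕ.* f e₀ ℕ.+ rest)      ∎
      where
      open ≡-Reasoning
      e₀ = e Fin.zero
      rest = ∑[ p < k ] (below i (e (Fin.suc p)) ℕ.* f (e (Fin.suc p)))
    ... | no e₀≮i rewrite filter-reject (λ j → toℕ j <? i) {x = e Fin.zero} {xs = tabulate (e ∘ Fin.suc)} e₀≮i =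
      over-tabulate (e ∘ Fin.suc)

  sumFirst-toℚ-+ : ∀ {n} i (f g : Fin n → ℕ)
    → sumFirst (toℚ ∘ f) i + sumFirst (toℚ ∘ g) i
      ≡ toℚ (∑[ p < n ] (below i p ℕ.* f p) ℕ.+ ∑[ p < n ] (below i p ℕ.* g p))
  sumFirst-toℚ-+ {n} i f g = trans (cong₂ _+_ (sumFirst-toℚ i f) (sumFirst-toℚ i g))
    (sym (toℚ-homo-+ (∑[ p < n ] (below i p ℕ.* f p)) (∑[ p < n ] (below i p ℕ.* g p))))

module Witness {n₁ : ℕ} (τ : Permutation′ (suc n₁)) where
  open import Data.Nat using (ℕ; suc; _+_; _*_; _∸_; _≤_; _<_; s≤s⁻¹)
  open import Data.Nat.Properties
  open import Data.Nat.Tactic.RingSolver using (solve-∀)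
  open import Data.Fin using (Fin; toℕ; fromℕ; opposite)
  open import Data.Fin.Properties using (toℕ<n; toℕ-injective; opposite-prop; ≤fromℕ)
  open import Data.Fin.Permutation using (Permutation′; _⟨$⟩ʳ_; _⟨$⟩ˡ_; _∘ₚ_; reverse; flip; inverseʳ)
  open import Algebra.Properties.Semiring.Sum +-*-semiring using (sum-syntax; ∑-permute; sum-cong-≗)
  open import Data.Sum using (inj₁; inj₂)
  open import Data.Product using (_,_)
  open import Relation.Binary.PropositionalEquality
  open FinSums
  open TopImage
  open Arithmetic
  open import Function using (_∘_)

  private
    n : ℕ
    n = suc n₁

  L : Fin n → ℕ
  L p = toℕ (opposite p)

  L+toℕ : ∀ p → L p + toℕ p ≡ n₁
  L+toℕ p = trans (cong (_+ toℕ p) (opposite-prop p)) (m∸n+n≡m (s≤s⁻¹ (toℕ<n p)))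

  B₀ : Fin n → ℕ
  B₀ p = n * L p + L (τ ⟨$⟩ʳ p)

  B₀-strictly-antitone : ∀ {j k} → toℕ j < toℕ k → B₀ k < B₀ j
  B₀-strictly-antitone {j} {k} j<k = begin-strict
    n * L k + L (τ ⟨$⟩ʳ k)  <⟨ +-monoʳ-< (n * L k) (toℕ<n (opposite (τ ⟨$⟩ʳ k))) ⟩
    n * L k + n             ≡⟨ +-comm (n * L k) n ⟩
    n + n * L k             ≡⟨ *-suc n (L k) ⟨
    n * suc (L k)           ≤⟨ *-monoʳ-≤ n Lk<Lj ⟩
    n * L j                 ≤⟨ m≤m+n (n * L j) (L (τ ⟨$⟩ʳ j)) ⟩
    B₀ j                    ∎
    where
    open ≤-Reasoning
    Lk<Lj : L k < L j
    Lk<Lj = +-cancelʳ-< (toℕ j) (L k) (L j) (begin-strict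
      L k + toℕ j  <⟨ +-monoʳ-< (L k) j<k ⟩
      L k + toℕ k  ≡⟨ trans (L+toℕ k) (sym (L+toℕ j)) ⟩
      L j + toℕ j  ∎)

  B₀-antitone : ∀ {j k} → toℕ j ≤ toℕ k → B₀ k ≤ B₀ j
  B₀-antitone j≤k with m≤n⇒m<n∨m≡n j≤k
  ... | inj₁ j<k = <⇒≤ (B₀-strictly-antitone j<k)
  ... | inj₂ j≡k = ≤-reflexive (cong B₀ (sym (toℕ-injective j≡k)))

  last : Fin n
  last = fromℕ n₁

  b : Fin n → ℕ
  b p = B₀ p ∸ B₀ last

  b+B₀[last] : ∀ p → b p + B₀ last ≡ B₀ p
  b+B₀[last] p = m∸n+n≡m (B₀-antitone (≤fromℕ p))

  b-last : b last ≡ 0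
  b-last = n∸n≡0 (B₀ last)

  b-strictly-antitone : ∀ {j k} → toℕ j < toℕ k → b k < b j
  b-strictly-antitone {j} {k} j<k = ∸-monoˡ-< (B₀-strictly-antitone j<k) (B₀-antitone (≤fromℕ k))

  module _ {i : ℕ} (i≤n : i ≤ n) where
    ∑-below-b-shift : (g : Fin n → Fin n)
      → ∑[ p < n ] (below i p * b (g p)) + i * B₀ last ≡ ∑[ p < n ] (below i p * B₀ (g p))
    ∑-below-b-shift g = begin
      ∑[ p < n ] (below i p * b (g p)) + i * B₀ last
        ≡⟨ cong (λ k → ∑[ p < n ] (below i p * b (g p)) + k * B₀ last) (∑-below i≤n) ⟨
      ∑[ p < n ] (below i p * b (g p)) + ∑[ p < n ] below i p * B₀ last
        ≡⟨ cong (∑[ p < n ] (below i p * b (g p)) +_) (∑-weighted-const {n} (below i) (B₀ last)) ⟨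
      ∑[ p < n ] (below i p * b (g p)) + ∑[ p < n ] (below i p * B₀ last)
        ≡⟨ ∑-weighted-+ {n} (below i) (b ∘ g) (λ _ → B₀ last) ⟨
      ∑[ p < n ] (below i p * (b (g p) + B₀ last))
        ≡⟨ sum-cong-≗ {n} (λ p → cong (below i p *_) (b+B₀[last] (g p))) ⟩
      ∑[ p < n ] (below i p * B₀ (g p)) ∎
      where open ≡-Reasoning

    ∑-below-B₀ : ∑[ p < n ] (below i p * B₀ p)
                 ≡ n * ∑[ p < n ] (below i p * L p) + ∑[ p < n ] (below i p * L (τ ⟨$⟩ʳ p))
    ∑-below-B₀ = trans (∑-weighted-+ {n} (below i) (λ p → n * L p) (λ p → L (τ ⟨$⟩ʳ p)))
      (cong (_+ ∑[ p < n ] (below i p * L (τ ⟨$⟩ʳ p))) (∑-weighted-*ˡ {n} (below i) L n))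

    ∑-below-B₀∘τ⁻¹ : ∑[ p < n ] (below i p * B₀ (τ ⟨$⟩ˡ p))
                     ≡ n * ∑[ p < n ] (below i p * L (τ ⟨$⟩ˡ p)) + ∑[ p < n ] (below i p * L p)
    ∑-below-B₀∘τ⁻¹ = trans (∑-weighted-+ {n} (below i) (λ p → n * L (τ ⟨$⟩ˡ p)) (λ p → L (τ ⟨$⟩ʳ (τ ⟨$⟩ˡ p))))
      (cong₂ _+_ (∑-weighted-*ˡ {n} (below i) (λ p → L (τ ⟨$⟩ˡ p)) n)
                 (sum-cong-≗ {n} (λ p → cong (λ q → below i p * L q) (inverseʳ τ {p}))))

    ∑-below-L+∑-below-toℕ : ∑[ p < n ] (below i p * L p) + ∑[ p < n ] (below i p * toℕ p) ≡ i * n₁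
    ∑-below-L+∑-below-toℕ = begin
      ∑[ p < n ] (below i p * L p) + ∑[ p < n ] (below i p * toℕ p) ≡⟨ ∑-weighted-+ {n} (below i) L toℕ ⟨
      ∑[ p < n ] (below i p * (L p + toℕ p))                       ≡⟨ sum-cong-≗ {n} (λ p → cong (below i p *_) (L+toℕ p)) ⟩
      ∑[ p < n ] (below i p * n₁)                                   ≡⟨ ∑-weighted-const {n} (below i) n₁ ⟩
      ∑[ p < n ] below i p * n₁                                     ≡⟨ cong (_* n₁) (∑-below i≤n) ⟩
      i * n₁                                                        ∎
      where open ≡-Reasoning

  ∑-L∘τ≡∑-L : ∑[ p < n ] (below n p * L (τ ⟨$⟩ʳ p)) ≡ ∑[ p < n ] (below n p * L p)
  ∑-L∘τ≡∑-L = trans (∑-below-all (λ p → L (τ ⟨$⟩ʳ p))) (trans (sym (∑-permute L τ)) (sym (∑-below-all L)))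

  ∑-L+∑-L : ∑[ p < n ] (below n p * L p) + ∑[ p < n ] (below n p * L p) ≡ n * n₁
  ∑-L+∑-L = trans (cong (∑[ p < n ] (below n p * L p) +_) ∑-L≡∑-toℕ) (∑-below-L+∑-below-toℕ (≤-refl {n}))
    where
    ∑-L≡∑-toℕ : ∑[ p < n ] (below n p * L p) ≡ ∑[ p < n ] (below n p * toℕ p)
    ∑-L≡∑-toℕ = trans (∑-below-all L) (trans (sym (∑-permute (toℕ {n}) reverse)) (sym (∑-below-all (toℕ {n}))))

  b-average-< : ∀ {i} → i ≤ n → InΔ τ i
    → 2 * i * ∑[ p < n ] (below n p * b p) < n * (∑[ p < n ] (below i p * b p) + ∑[ p < n ] (below i p * b (τ ⟨$⟩ˡ p)))
  b-average-< {i} i≤n Δ =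
    averages-shift-< n i X Y (B₀ last) X₀ Y₀ X-shift (∑-below-b-shift (≤-refl {n}) (λ p → p)) X₀-Y₀-<
    where
    X Y X₀ Y₀ A Z Iσ Iτ Q : ℕ
    X = ∑[ p < n ] (below i p * b p) + ∑[ p < n ] (below i p * b (τ ⟨$⟩ˡ p))
    Y = ∑[ p < n ] (below n p * b p)
    X₀ = ∑[ p < n ] (below i p * B₀ p) + ∑[ p < n ] (below i p * B₀ (τ ⟨$⟩ˡ p))
    Y₀ = ∑[ p < n ] (below n p * B₀ p)
    A = ∑[ p < n ] (below i p * L p)
    Z = ∑[ p < n ] (below i p * toℕ p)
    Iσ = ∑[ p < n ] (below i p * L (τ ⟨$⟩ˡ p))
    Iτ = ∑[ p < n ] (below i p * L (τ ⟨$⟩ʳ p))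
    Q = ∑[ p < n ] (below n p * L p)

    X-shift : X + (i * B₀ last + i * B₀ last) ≡ X₀
    X-shift = trans (shuffle (∑[ p < n ] (below i p * b p)) (∑[ p < n ] (below i p * b (τ ⟨$⟩ˡ p))) (i * B₀ last))
      (cong₂ _+_ (∑-below-b-shift i≤n (λ p → p)) (∑-below-b-shift i≤n (τ ⟨$⟩ˡ_)))
      where
      shuffle : ∀ x y c → (x + y) + (c + c) ≡ (x + c) + (y + c)
      shuffle = solve-∀

    Z<Iτ : Z < Iτ
    Z<Iτ with InΔ⇒misplaced τ i≤n Δ
    ... | y , y<i , misplaced = ∑-below-toℕ-< (τ ∘ₚ reverse) i≤n y y<i misplaced

    X₀-Y₀-< : 2 * i * Y₀ < n * X₀
    X₀-Y₀-< = subst₂ (λ Y₀′ X₀′ → 2 * i * Y₀′ < n * X₀′)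
      (sym (trans (∑-below-B₀ (≤-refl {n})) (cong (n * Q +_) ∑-L∘τ≡∑-L)))
      (sym (cong₂ _+_ (∑-below-B₀ i≤n) (∑-below-B₀∘τ⁻¹ i≤n)))
      (rearranged-averages-< n₁ i A Z Iσ Iτ Q (∑-below-toℕ-≤ (flip τ ∘ₚ reverse) i≤n) Z<Iτ
        (∑-below-L+∑-below-toℕ i≤n) ∑-L+∑-L)

open import Data.Nat using (ℕ; suc; _<_; pred) renaming (_*_ to _*ℕ_)
open import Data.Fin using (Fin; fromℕ; opposite) renaming (_<_ to _<ᶠ_)
open import Data.Fin.Permutation using (Permutation′; _⟨$⟩ʳ_; _⟨$⟩ˡ_)
open import Data.Rational using (ℚ; 0ℚ; _+_; _*_; _/_) renaming (_<_ to _<ℚ_)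
open import Data.Integer using (+_)
open import Data.Product using (Σ; _×_; _,_)
open import Relation.Binary.PropositionalEquality using (_≡_; cong; sym; subst₂)
open import Relation.Nullary using (¬_)
open import Data.Nat.Properties using (<⇒≤)
open Embedding

lemma6p2 : (m : ℕ) → (τ : Permutation′ (suc (suc m)))
    → ¬ (∀ (i : Fin (suc (suc m))) → τ ⟨$⟩ʳ i ≡ opposite i)
    → Σ (Fin (suc (suc m)) → ℚ) λ b →
        (∀ (j k : Fin (suc (suc m))) → j <ᶠ k → b k <ℚ b j)
        × (b (fromℕ (suc m)) ≡ 0ℚ)
        × (∀ (k : ℕ) → suc k < suc (suc m) → InΔ τ (suc k)
            → sumFirst b (suc (suc m)) * ((+ 1) / suc (suc m))
              <ℚ (sumFirst b (suc k) + sumFirst (λ j → b (τ ⟨$⟩ˡ j)) (suc k)) * ((+ 1) / (2 *ℕ suc k)))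
lemma6p2 m τ _ =
  (λ p → toℚ (b p)) ,
  (λ j k j<k → toℚ-mono-< (b-strictly-antitone j<k)) ,
  cong toℚ b-last ,
  λ k sk<n Δ → subst₂ (λ Y X → Y * ((+ 1) / suc (suc m)) <ℚ X * ((+ 1) / (2 *ℕ suc k)))
    (sym (sumFirst-toℚ (suc (suc m)) b))
    (sym (sumFirst-toℚ-+ (suc k) b (λ j → b (τ ⟨$⟩ˡ j))))
    (toℚ-ratio-< (pred (2 *ℕ suc k)) (suc m) (b-average-< (<⇒≤ sk<n) Δ))
  where open Witness τ
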